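{- Let $(T_\alpha,P_\alpha)$ be a stage of the transfinite sequence (defined in the context) which is consistent. If $\mathbb N\models\Pi(\ulcorner\varphi\urcorner)$, then $(\mathbb N,T_\alpha,P_\alpha)\models_{SK}\varphi\Leftrightarrow\neg T\ulcorner\varphi\urcorner$, i.e. both sequents $\varphi\Rightarrow\neg T\ulcorner\varphi\urcorner$ and $\neg T\ulcorner\varphi\urcorner\Rightarrow\varphi$ are satisfied.
   Context: $\mathcal L=\mathcal L_{\mathbb N}\cup\{T,P\}$, Tait style (literals $s=t,s\neq t,Tt,\neg Tt,Pt,\neg Pt$; $\wedge,\vee,\forall,\exists$; negation by De Morgan with $\neg\neg\varphi:=\varphi$), fixed Gödel numbering. Interpretations $(T,P)$ with $T=(T^+,T^-)$, $P=(P^+,P^-)\subseteq\omega$; $\models_{SK}$ is Strong Kleene satisfaction in $(\mathbb N,T,P)$ ($Tt$ iff $\mathrm{val}(t)\in T^+$, $\neg Tt$ iff $\mathrm{val}(t)\in T^-$, likewise $P$); a sequent $\Gamma\Rightarrow\Delta$ is satisfied iff whenever all of $\Gamma$ hold some member of $\Delta$ holds. $(T,P)$ is consistent iff $T^+\cap T^-=\emptyset$ and $P^+\cap P^-=\emptyset$. $\mathrm{PA}[\mathrm{SK}]$ is Peano arithmetic over the Strong Kleene sequent calculus $\mathrm{SK}_=$ (no right negation rule; Ref and Repl for identity), with induction rule for all $\mathcal L$-formulas. $B(x)$ is an arithmetical formula representing the set of sentences $\varphi$ with $\mathrm{PA}[\mathrm{SK}]\vdash\varphi\Leftrightarrow\neg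 T\varphi$ and $\mathrm{PA}[\mathrm{SK}]\vdash\neg\varphi\Leftrightarrow T\varphi$; $\Pi(x):=B(x)\vee B(\neg x)$. $\mathscr P(x)$: $x$ is a sentence and one of: $\Pi(x)$; $x=Ts$ and $P\,\mathrm{val}(s)$; $x=\neg Ts$ and $P\,\mathrm{val}(s)$; $x=\psi\wedge\theta$ and $(P\psi\wedge P\theta)\vee(T\psi\wedge P\theta)\vee(T\theta\wedge P\psi)$; $x=\psi\vee\theta$ and $(P\psi\wedge P\theta)\vee(\neg T\psi\wedge P\theta)\vee(\neg T\theta\wedge P\psi)$; $x=\forall v\psi$ and $\exists yP\psi(\dot y)\wedge\forall y(P\psi(\dot y)\vee T\psi(\dot y))$; $x=\exists v\psi$ and $\exists yP\psi(\dot y)\wedge\forall y(P\psi(\dot y)\vee\neg T\psi(\dot y))$. $\Gamma_{\mathscr{TP}}(T,P)=\big((\{\#\varphi:\models_{SK}\varphi\},\{\#\varphi:\models_{SK}\neg\varphi\}),(\{\#\varphi:\models_{SK}\mathscr P(\ulcorner\varphi\urcorner)\},\{\#\varphi:\models_{SK}\varphi\vee\neg\varphi\})\big)$, satisfaction in $(\mathbb N,T,P)$. Sequence: $(T_0,P_0)$ all empty, $(T_{\beta+1},P_{\beta+1})=\Gamma_{\mathscr{TP}}(T_\beta,P_\beta)$, unions at limits. -}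

module Defs where

open import Data.Nat using (ℕ; zero; suc; _+_; _*_; _≡ᵇ_; _<ᵇ_; pred)
open import Data.Bool using (Bool; true; false; _∧_; if_then_else_)
open import Data.List using (List; []; _∷_; map; [_])
open import Data.List.Membership.Propositional using (_∈_)
open import Data.List.Relation.Binary.Subset.Propositional using (_⊆_)
open import Data.List.Relation.Unary.All using (All)
open import Data.List.Relation.Unary.Any using (Any)
open import Data.Product using (Σ; _×_; _,_)
open import Data.Sum using (_⊎_)
open import Data.Empty using (⊥)
open import Relation.Nullary using (¬_)
open import Relation.Binary.PropositionalEquality using (_≡_)

-- Syntax of L = L_N ∪ {T, P}  (L_N = 0, S, +, ×), Tait style,
-- de Bruijn indices for variables.

data Tm : Set where
  var   : ℕ → Tm
  zer   : Tm
  suc'  : Tm → Tm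
  plus  : Tm → Tm → Tm
  times : Tm → Tm → Tm

data Fm : Set where
  eqF neqF  : Tm → Tm → Fm
  Tp Tn     : Tm → Fm
  Pp Pn     : Tm → Fm
  andF orF  : Fm → Fm → Fm
  allF exF  : Fm → Fm

neg : Fm → Fm
neg (eqF s t)  = neqF s t
neg (neqF s t) = eqF s t
neg (Tp t)     = Tn t
neg (Tn t)     = Tp t
neg (Pp t)     = Pn t
neg (Pn t)     = Pp t
neg (andF φ ψ) = orF (neg φ) (neg ψ)
neg (orF φ ψ)  = andF (neg φ) (neg ψ)
neg (allF φ)   = exF (neg φ)
neg (exF φ)    = allF (neg φ)

num : ℕ → Tm
num zero    = zer
num (suc n) = suc' (num n)

closedTm : ℕ → Tm → Bool
closedTm k (var i)     = i <ᵇ k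
closedTm k zer         = true
closedTm k (suc' t)    = closedTm k t
closedTm k (plus s t)  = closedTm k s ∧ closedTm k t
closedTm k (times s t) = closedTm k s ∧ closedTm k t

closedFm : ℕ → Fm → Bool
closedFm k (eqF s t)  = closedTm k s ∧ closedTm k t
closedFm k (neqF s t) = closedTm k s ∧ closedTm k t
closedFm k (Tp t)     = closedTm k t
closedFm k (Tn t)     = closedTm k t
closedFm k (Pp t)     = closedTm k t
closedFm k (Pn t)     = closedTm k t
closedFm k (andF φ ψ) = closedFm k φ ∧ closedFm k ψ
closedFm k (orF φ ψ)  = closedFm k φ ∧ closedFm k ψ
closedFm k (allF φ)   = closedFm (suc k) φ
closedFm k (exF φ)    = closedFm (suc k) φ

Sentence : Fm → Set
Sentence φ = closedFm 0 φ ≡ true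

renTm : (ℕ → ℕ) → Tm → Tm
renTm r (var i)     = var (r i)
renTm r zer         = zer
renTm r (suc' t)    = suc' (renTm r t)
renTm r (plus s t)  = plus (renTm r s) (renTm r t)
renTm r (times s t) = times (renTm r s) (renTm r t)

liftR : (ℕ → ℕ) → ℕ → ℕ
liftR r zero    = zero
liftR r (suc i) = suc (r i)

renFm : (ℕ → ℕ) → Fm → Fm
renFm r (eqF s t)  = eqF (renTm r s) (renTm r t)
renFm r (neqF s t) = neqF (renTm r s) (renTm r t)
renFm r (Tp t)     = Tp (renTm r t)
renFm r (Tn t)     = Tn (renTm r t)
renFm r (Pp t)     = Pp (renTm r t)
renFm r (Pn t)     = Pn (renTm r t)
renFm r (andF φ ψ) = andF (renFm r φ) (renFm r ψ)
renFm r (orF φ ψ)  = orF (renFm r φ) (renFm r ψ)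
renFm r (allF φ)   = allF (renFm (liftR r) φ)
renFm r (exF φ)    = exF (renFm (liftR r) φ)

shift : Fm → Fm
shift = renFm suc

subTm : (ℕ → Tm) → Tm → Tm
subTm σ (var i)     = σ i
subTm σ zer         = zer
subTm σ (suc' t)    = suc' (subTm σ t)
subTm σ (plus s t)  = plus (subTm σ s) (subTm σ t)
subTm σ (times s t) = times (subTm σ s) (subTm σ t)

liftS : (ℕ → Tm) → ℕ → Tm
liftS σ zero    = var zero
liftS σ (suc i) = renTm suc (σ i)

subFm : (ℕ → Tm) → Fm → Fm
subFm σ (eqF s t)  = eqF (subTm σ s) (subTm σ t)
subFm σ (neqF s t) = neqF (subTm σ s) (subTm σ t)
subFm σ (Tp t)     = Tp (subTm σ t)
subFm σ (Tn t)     = Tn (subTm σ t)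
subFm σ (Pp t)     = Pp (subTm σ t)
subFm σ (Pn t)     = Pn (subTm σ t)
subFm σ (andF φ ψ) = andF (subFm σ φ) (subFm σ ψ)
subFm σ (orF φ ψ)  = orF (subFm σ φ) (subFm σ ψ)
subFm σ (allF φ)   = allF (subFm (liftS σ) φ)
subFm σ (exF φ)    = exF (subFm (liftS σ) φ)

sub0 : Tm → Fm → Fm
sub0 t = subFm σ
  where
  σ : ℕ → Tm
  σ zero    = t
  σ (suc i) = var i

subSuc : Fm → Fm
subSuc = subFm σ
  where
  σ : ℕ → Tm
  σ zero    = suc' (var zero)
  σ (suc i) = var (suc i)

-- A fixed (injective) Gödel numbering via Cantor pairing

tri : ℕ → ℕ
tri zero    = zero
tri (suc k) = suc k + tri k

pair : ℕ → ℕ → ℕ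
pair a b = tri (a + b) + b

codeTm : Tm → ℕ
codeTm (var i)     = pair 0 i
codeTm zer         = pair 1 0
codeTm (suc' t)    = pair 2 (codeTm t)
codeTm (plus s t)  = pair 3 (pair (codeTm s) (codeTm t))
codeTm (times s t) = pair 4 (pair (codeTm s) (codeTm t))

code : Fm → ℕ
code (eqF s t)  = pair 0 (pair (codeTm s) (codeTm t))
code (neqF s t) = pair 1 (pair (codeTm s) (codeTm t))
code (Tp t)     = pair 2 (codeTm t)
code (Tn t)     = pair 3 (codeTm t)
code (Pp t)     = pair 4 (codeTm t)
code (Pn t)     = pair 5 (codeTm t)
code (andF φ ψ) = pair 6 (pair (code φ) (code ψ))
code (orF φ ψ)  = pair 7 (pair (code φ) (code ψ))
code (allF φ)   = pair 8 (code φ)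
code (exF φ)    = pair 9 (code φ)

⌜_⌝ : Fm → Tm
⌜ φ ⌝ = num (code φ)

-- Interpretations (T,P) = ((T⁺,T⁻),(P⁺,P⁻)), subsets of ω as predicates

record Interp : Set₁ where
  field
    T⁺ T⁻ P⁺ P⁻ : ℕ → Set
open Interp public

Consistent : Interp → Set
Consistent I = (∀ n → T⁺ I n → T⁻ I n → ⊥) × (∀ n → P⁺ I n → P⁻ I n → ⊥)

Env : Set
Env = ℕ → ℕ

_∷ₑ_ : ℕ → Env → Env
(n ∷ₑ ρ) zero    = n
(n ∷ₑ ρ) (suc i) = ρ i

ev : Env → Tm → ℕ
ev ρ (var i)     = ρ i
ev ρ zer         = zero
ev ρ (suc' t)    = suc (ev ρ t)
ev ρ (plus s t)  = ev ρ s + ev ρ t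
ev ρ (times s t) = ev ρ s * ev ρ t

SatE : Interp → Env → Fm → Set
SatE I ρ (eqF s t)  = ev ρ s ≡ ev ρ t
SatE I ρ (neqF s t) = ¬ (ev ρ s ≡ ev ρ t)
SatE I ρ (Tp t)     = T⁺ I (ev ρ t)
SatE I ρ (Tn t)     = T⁻ I (ev ρ t)
SatE I ρ (Pp t)     = P⁺ I (ev ρ t)
SatE I ρ (Pn t)     = P⁻ I (ev ρ t)
SatE I ρ (andF φ ψ) = SatE I ρ φ × SatE I ρ ψ
SatE I ρ (orF φ ψ)  = SatE I ρ φ ⊎ SatE I ρ ψ
SatE I ρ (allF φ)   = ∀ n → SatE I (n ∷ₑ ρ) φ
SatE I ρ (exF φ)    = Σ ℕ λ n → SatE I (n ∷ₑ ρ) φ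

-- satisfaction of sentences (the environment is irrelevant for them)
Sat : Interp → Fm → Set
Sat I φ = SatE I (λ _ → zero) φ

SatSeq : Interp → List Fm → List Fm → Set
SatSeq I Γ Δ = All (Sat I) Γ → Any (Sat I) Δ

-- PA[SK]: Peano arithmetic over the Strong Kleene sequent calculus SK_=
-- (no right negation rule; Ref and Repl for identity; induction rule
-- for all L-formulas).

infix 4 _⊢_
data _⊢_ : List Fm → List Fm → Set where
  ax      : ∀ {Γ Δ φ} → φ ∈ Γ → φ ∈ Δ → Γ ⊢ Δ
  struct  : ∀ {Γ Δ Γ' Δ'} → Γ ⊢ Δ → Γ ⊆ Γ' → Δ ⊆ Δ' → Γ' ⊢ Δ'
  cut     : ∀ {Γ Δ} φ → Γ ⊢ φ ∷ Δ → φ ∷ Γ ⊢ Δ → Γ ⊢ Δ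
  negL    : ∀ {Γ Δ φ} → Γ ⊢ φ ∷ Δ → neg φ ∷ Γ ⊢ Δ
  andL    : ∀ {Γ Δ φ ψ} → φ ∷ ψ ∷ Γ ⊢ Δ → andF φ ψ ∷ Γ ⊢ Δ
  andR    : ∀ {Γ Δ φ ψ} → Γ ⊢ φ ∷ Δ → Γ ⊢ ψ ∷ Δ → Γ ⊢ andF φ ψ ∷ Δ
  orL     : ∀ {Γ Δ φ ψ} → φ ∷ Γ ⊢ Δ → ψ ∷ Γ ⊢ Δ → orF φ ψ ∷ Γ ⊢ Δ
  orR     : ∀ {Γ Δ φ ψ} → Γ ⊢ φ ∷ ψ ∷ Δ → Γ ⊢ orF φ ψ ∷ Δ
  allL    : ∀ {Γ Δ φ} t → sub0 t φ ∷ Γ ⊢ Δ → allF φ ∷ Γ ⊢ Δ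
  allR    : ∀ {Γ Δ φ} → map shift Γ ⊢ φ ∷ map shift Δ → Γ ⊢ allF φ ∷ Δ
  exL     : ∀ {Γ Δ φ} → φ ∷ map shift Γ ⊢ map shift Δ → exF φ ∷ Γ ⊢ Δ
  exR     : ∀ {Γ Δ φ} t → Γ ⊢ sub0 t φ ∷ Δ → Γ ⊢ exF φ ∷ Δ
  ref     : ∀ {Γ Δ} t → Γ ⊢ eqF t t ∷ Δ
  repl    : ∀ {Γ Δ} s t φ → eqF s t ∷ sub0 s φ ∷ Γ ⊢ sub0 t φ ∷ Δ
  eqLEM   : ∀ {Γ Δ} s t → Γ ⊢ eqF s t ∷ neqF s t ∷ Δ
  paS0    : ∀ {Γ Δ} s → eqF (suc' s) zer ∷ Γ ⊢ Δ
  paSinj  : ∀ {Γ Δ} s t → eqF (suc' s) (suc' t) ∷ Γ ⊢ eqF s t ∷ Δ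
  paPlus0 : ∀ {Γ Δ} s → Γ ⊢ eqF (plus s zer) s ∷ Δ
  paPlusS : ∀ {Γ Δ} s t → Γ ⊢ eqF (plus s (suc' t)) (suc' (plus s t)) ∷ Δ
  paTimes0 : ∀ {Γ Δ} s → Γ ⊢ eqF (times s zer) zer ∷ Δ
  paTimesS : ∀ {Γ Δ} s t →
    Γ ⊢ eqF (times s (suc' t)) (plus (times s t) s) ∷ Δ
  -- induction rule (var 0 is the eigenvariable)
  ind     : ∀ {Γ Δ} φ t → φ ∷ map shift Γ ⊢ subSuc φ ∷ map shift Δ →
            sub0 zer φ ∷ Γ ⊢ sub0 t φ ∷ Δ

PA⊢ : List Fm → List Fm → Set
PA⊢ Γ Δ = Γ ⊢ Δ

-- B : sentences φ with PA[SK] ⊢ φ ⇔ ¬T⌜φ⌝ and PA[SK] ⊢ ¬φ ⇔ T⌜φ⌝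
-- (⇔ = derivability of both sequents).  N ⊨ B(⌜φ⌝) iff InB φ.

InB : Fm → Set
InB φ = Sentence φ
      × PA⊢ [ φ ] [ Tn ⌜ φ ⌝ ] × PA⊢ [ Tn ⌜ φ ⌝ ] [ φ ]
      × PA⊢ [ neg φ ] [ Tp ⌜ φ ⌝ ] × PA⊢ [ Tp ⌜ φ ⌝ ] [ neg φ ]

InΠ : Fm → Set
InΠ φ = InB φ ⊎ InB (neg φ)

-- (N,T,P) ⊨_SK 𝒫(⌜φ⌝), unfolded (𝒫 is positive in T,P; its syntactic
-- and Π-parts are arithmetical).  The "x is a sentence" conjunct is
-- imposed in Jump below.

Pclause : Interp → Fm → Set
Pclause I (Tp s) = P⁺ I (ev (λ _ → zero) s)
Pclause I (Tn s) = P⁺ I (ev (λ _ → zero) s)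
Pclause I (andF ψ θ) =
    (P⁺ I (code ψ) × P⁺ I (code θ))
  ⊎ (T⁺ I (code ψ) × P⁺ I (code θ))
  ⊎ (T⁺ I (code θ) × P⁺ I (code ψ))
Pclause I (orF ψ θ) =
    (P⁺ I (code ψ) × P⁺ I (code θ))
  ⊎ (T⁻ I (code ψ) × P⁺ I (code θ))
  ⊎ (T⁻ I (code θ) × P⁺ I (code ψ))
Pclause I (allF ψ) =
    (Σ ℕ λ y → P⁺ I (code (sub0 (num y) ψ)))
  × (∀ y → P⁺ I (code (sub0 (num y) ψ)) ⊎ T⁺ I (code (sub0 (num y) ψ)))
Pclause I (exF ψ) =
    (Σ ℕ λ y → P⁺ I (code (sub0 (num y) ψ)))
  × (∀ y → P⁺ I (code (sub0 (num y) ψ)) ⊎ T⁻ I (code (sub0 (num y) ψ)))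
Pclause I _ = ⊥

SatScrP : Interp → Fm → Set
SatScrP I φ = Sentence φ × (InΠ φ ⊎ Pclause I φ)

CodesOf : (Fm → Set) → ℕ → Set
CodesOf Q n = Σ Fm λ φ → Sentence φ × (code φ ≡ n) × Q φ

Jump : Interp → Interp
Jump I = record
  { T⁺ = CodesOf (λ φ → Sat I φ)
  ; T⁻ = CodesOf (λ φ → Sat I (neg φ))
  ; P⁺ = CodesOf (λ φ → SatScrP I φ)
  ; P⁻ = CodesOf (λ φ → Sat I (orF φ (neg φ)))
  }

data Ord : Set where
  zeroO : Ord
  sucO  : Ord → Ord
  limO  : (ℕ → Ord) → Ord

emptyI : Interp
emptyI = record { T⁺ = λ _ → ⊥ ; T⁻ = λ _ → ⊥ ; P⁺ = λ _ → ⊥ ; P⁻ = λ _ → ⊥ }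

stage : Ord → Interp
stage zeroO    = emptyI
stage (sucO α) = Jump (stage α)
stage (limO f) = record
  { T⁺ = λ n → Σ ℕ λ k → T⁺ (stage (f k)) n
  ; T⁻ = λ n → Σ ℕ λ k → T⁻ (stage (f k)) n
  ; P⁺ = λ n → Σ ℕ λ k → P⁺ (stage (f k)) n
  ; P⁻ = λ n → Σ ℕ λ k → P⁻ (stage (f k)) n
  }

{-# OPTIONS --safe #-}
-- A sentence φ in B is a liar: PA[SK] proves φ ⇔ ¬T⌜φ⌝ and ¬φ ⇔ T⌜φ⌝.  PA[SK] is sound in
-- every consistent Strong Kleene model, so at a consistent stage where ⌜φ⌝ is in neither T⁺
-- nor T⁻, neither φ nor ¬φ holds.  The jump puts ⌜φ⌝ into T⁺ (T⁻) at stage α+1 only if φ (¬φ)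
-- holds at stage α, and the predecessors of a consistent stage are consistent because the
-- sequence increases; so by induction on α, ⌜φ⌝ never enters T⁺ or T⁻ at a consistent stage,
-- φ never holds, and both sequents are satisfied vacuously.  If instead ¬φ ∈ B, then φ = ¬¬φ
-- fails for the same reason, and ⌜φ⌝ ∈ T⁻ would need ¬φ to hold at an earlier stage.
-- Soundness is proved constructively by Friedman's A-translation.
module Submission where

open import Defs
open import Function using (id; _∘_; flip)
open import Function.Bundles using (_⇔_; mk⇔; module Equivalence)
open import Data.Nat using (ℕ; zero; suc; _+_; _*_; _≤_; _<_; z≤n; s≤s; _≟_)
open import Data.Nat.Properties
  using ( +-comm; +-suc; +-identityʳ; *-suc; *-zeroʳ; +-cancelˡ-≡; +-cancelʳ-≡; suc-injective
        ; +-mono-≤; +-monoʳ-≤; m≤m+n; m≤n+m; n<1+n; <-cmp; <⇒≢; module ≤-Reasoning )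
open import Data.Empty using (⊥; ⊥-elim)
open import Data.Product as Product using (_×_; _,_; proj₁; proj₂; ∃)
open import Data.Product.Function.NonDependent.Propositional using (_×-⇔_)
open import Data.Sum as Sum using (_⊎_; inj₁; inj₂)
open import Data.Sum.Function.Propositional using (_⊎-⇔_)
open import Data.List using ([]; _∷_; map; [_])
open import Data.List.Relation.Unary.All as All using (All; []; _∷_)
import Data.List.Relation.Unary.All.Properties as All
open import Data.List.Relation.Unary.Any as Any using (Any; here; there)
import Data.List.Relation.Unary.Any.Properties as Any
open import Data.List.Relation.Binary.Subset.Propositional.Properties using (Any-resp-⊆)
open import Relation.Nullary using (¬_; yes; no; contradiction)
open import Relation.Binary.PropositionalEquality hiding ([_])
open import Relation.Binary.Definitions using (tri<; tri≈; tri>)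

open Equivalence using (to; from)

tri-mono-≤ : ∀ {m n} → m ≤ n → tri m ≤ tri n
tri-mono-≤ z≤n       = z≤n
tri-mono-≤ (s≤s m≤n) = +-mono-≤ (s≤s m≤n) (tri-mono-≤ m≤n)

pair-mono-< : ∀ {a b c d} → a + b < c + d → pair a b < pair c d
pair-mono-< {a} {b} {c} {d} a+b<c+d = begin-strict
  tri (a + b) + b        ≤⟨ +-monoʳ-≤ (tri (a + b)) (m≤n+m b a) ⟩
  tri (a + b) + (a + b)  ≡⟨ +-comm (tri (a + b)) (a + b) ⟩
  (a + b) + tri (a + b)  <⟨ n<1+n _ ⟩
  tri (suc (a + b))      ≤⟨ tri-mono-≤ a+b<c+d ⟩
  tri (c + d)            ≤⟨ m≤m+n (tri (c + d)) d ⟩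
  pair c d               ∎
  where open ≤-Reasoning

pair-injective : ∀ a b c d → pair a b ≡ pair c d → a ≡ c × b ≡ d
pair-injective a b c d eq with <-cmp (a + b) (c + d)
... | tri< lt _ _ = contradiction eq (<⇒≢ (pair-mono-< {a} {b} {c} {d} lt))
... | tri> _ _ gt = contradiction (sym eq) (<⇒≢ (pair-mono-< {c} {d} {a} {b} gt))
... | tri≈ _ a+b≡c+d _ = a≡c , b≡d
  where
  b≡d : b ≡ d
  b≡d = +-cancelˡ-≡ (tri (a + b)) b d (trans eq (cong (λ s → tri s + d) (sym a+b≡c+d)))
  a≡c : a ≡ c
  a≡c = +-cancelʳ-≡ b a c (trans a+b≡c+d (cong (c +_) (sym b≡d)))

pair₂-injective : ∀ k a b c d → pair k (pair a b) ≡ pair k (pair c d) → a ≡ c × b ≡ d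
pair₂-injective k a b c d eq = pair-injective a b c d (proj₂ (pair-injective k (pair a b) k (pair c d) eq))

-- Indexing by the Gödel tag lets unification discard every constructor but one,
-- so injectivity needs no quadratic case split.

data TmShape : ℕ → Tm → Set where
  isVar   : ∀ i → TmShape 0 (var i)
  isZer   : TmShape 1 zer
  isSuc   : ∀ t → TmShape 2 (suc' t)
  isPlus  : ∀ s t → TmShape 3 (plus s t)
  isTimes : ∀ s t → TmShape 4 (times s t)

tmShape : ∀ n p t → codeTm t ≡ pair n p → TmShape n t
tmShape n p (var i)     eq with refl , _ ← pair-injective 0 i n p eq = isVar i
tmShape n p zer         eq with refl , _ ← pair-injective 1 0 n p eq = isZer
tmShape n p (suc' t)    eq with refl , _ ← pair-injective 2 (codeTm t) n p eq = isSuc t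
tmShape n p (plus s t)  eq with refl , _ ← pair-injective 3 (pair (codeTm s) (codeTm t)) n p eq = isPlus s t
tmShape n p (times s t) eq with refl , _ ← pair-injective 4 (pair (codeTm s) (codeTm t)) n p eq = isTimes s t

codeTm-injective : ∀ s t → codeTm s ≡ codeTm t → s ≡ t
codeTm-injective (var i) t eq with isVar j ← tmShape 0 i t (sym eq) =
  cong var (proj₂ (pair-injective 0 i 0 j eq))
codeTm-injective zer t eq with isZer ← tmShape 1 0 t (sym eq) = refl
codeTm-injective (suc' s) t eq with isSuc t′ ← tmShape 2 (codeTm s) t (sym eq) =
  cong suc' (codeTm-injective s t′ (proj₂ (pair-injective 2 (codeTm s) 2 (codeTm t′) eq)))
codeTm-injective (plus s₁ s₂) t eq
  with isPlus t₁ t₂ ← tmShape 3 (pair (codeTm s₁) (codeTm s₂)) t (sym eq) =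
  let e₁ , e₂ = pair₂-injective 3 (codeTm s₁) (codeTm s₂) (codeTm t₁) (codeTm t₂) eq
  in cong₂ plus (codeTm-injective s₁ t₁ e₁) (codeTm-injective s₂ t₂ e₂)
codeTm-injective (times s₁ s₂) t eq
  with isTimes t₁ t₂ ← tmShape 4 (pair (codeTm s₁) (codeTm s₂)) t (sym eq) =
  let e₁ , e₂ = pair₂-injective 4 (codeTm s₁) (codeTm s₂) (codeTm t₁) (codeTm t₂) eq
  in cong₂ times (codeTm-injective s₁ t₁ e₁) (codeTm-injective s₂ t₂ e₂)

data Shape : ℕ → Fm → Set where
  isEq  : ∀ s t → Shape 0 (eqF s t)
  isNeq : ∀ s t → Shape 1 (neqF s t)
  isTp  : ∀ t → Shape 2 (Tp t)
  isTn  : ∀ t → Shape 3 (Tn t)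
  isPp  : ∀ t → Shape 4 (Pp t)
  isPn  : ∀ t → Shape 5 (Pn t)
  isAnd : ∀ φ ψ → Shape 6 (andF φ ψ)
  isOr  : ∀ φ ψ → Shape 7 (orF φ ψ)
  isAll : ∀ φ → Shape 8 (allF φ)
  isEx  : ∀ φ → Shape 9 (exF φ)

shape : ∀ n p φ → code φ ≡ pair n p → Shape n φ
shape n p (eqF s t)  eq with refl , _ ← pair-injective 0 (pair (codeTm s) (codeTm t)) n p eq = isEq s t
shape n p (neqF s t) eq with refl , _ ← pair-injective 1 (pair (codeTm s) (codeTm t)) n p eq = isNeq s t
shape n p (Tp t)     eq with refl , _ ← pair-injective 2 (codeTm t) n p eq = isTp t
shape n p (Tn t)     eq with refl , _ ← pair-injective 3 (codeTm t) n p eq = isTn t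
shape n p (Pp t)     eq with refl , _ ← pair-injective 4 (codeTm t) n p eq = isPp t
shape n p (Pn t)     eq with refl , _ ← pair-injective 5 (codeTm t) n p eq = isPn t
shape n p (andF φ ψ) eq with refl , _ ← pair-injective 6 (pair (code φ) (code ψ)) n p eq = isAnd φ ψ
shape n p (orF φ ψ)  eq with refl , _ ← pair-injective 7 (pair (code φ) (code ψ)) n p eq = isOr φ ψ
shape n p (allF φ)   eq with refl , _ ← pair-injective 8 (code φ) n p eq = isAll φ
shape n p (exF φ)    eq with refl , _ ← pair-injective 9 (code φ) n p eq = isEx φ

code-injective : ∀ φ ψ → code φ ≡ code ψ → φ ≡ ψ
code-injective (eqF s₁ s₂) ψ eq
  with isEq t₁ t₂ ← shape 0 (pair (codeTm s₁) (codeTm s₂)) ψ (sym eq) =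
  let e₁ , e₂ = pair₂-injective 0 (codeTm s₁) (codeTm s₂) (codeTm t₁) (codeTm t₂) eq
  in cong₂ eqF (codeTm-injective s₁ t₁ e₁) (codeTm-injective s₂ t₂ e₂)
code-injective (neqF s₁ s₂) ψ eq
  with isNeq t₁ t₂ ← shape 1 (pair (codeTm s₁) (codeTm s₂)) ψ (sym eq) =
  let e₁ , e₂ = pair₂-injective 1 (codeTm s₁) (codeTm s₂) (codeTm t₁) (codeTm t₂) eq
  in cong₂ neqF (codeTm-injective s₁ t₁ e₁) (codeTm-injective s₂ t₂ e₂)
code-injective (Tp s) ψ eq with isTp t ← shape 2 (codeTm s) ψ (sym eq) =
  cong Tp (codeTm-injective s t (proj₂ (pair-injective 2 (codeTm s) 2 (codeTm t) eq)))
code-injective (Tn s) ψ eq with isTn t ← shape 3 (codeTm s) ψ (sym eq) =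
  cong Tn (codeTm-injective s t (proj₂ (pair-injective 3 (codeTm s) 3 (codeTm t) eq)))
code-injective (Pp s) ψ eq with isPp t ← shape 4 (codeTm s) ψ (sym eq) =
  cong Pp (codeTm-injective s t (proj₂ (pair-injective 4 (codeTm s) 4 (codeTm t) eq)))
code-injective (Pn s) ψ eq with isPn t ← shape 5 (codeTm s) ψ (sym eq) =
  cong Pn (codeTm-injective s t (proj₂ (pair-injective 5 (codeTm s) 5 (codeTm t) eq)))
code-injective (andF φ₁ φ₂) ψ eq
  with isAnd ψ₁ ψ₂ ← shape 6 (pair (code φ₁) (code φ₂)) ψ (sym eq) =
  let e₁ , e₂ = pair₂-injective 6 (code φ₁) (code φ₂) (code ψ₁) (code ψ₂) eq
  in cong₂ andF (code-injective φ₁ ψ₁ e₁) (code-injective φ₂ ψ₂ e₂)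
code-injective (orF φ₁ φ₂) ψ eq
  with isOr ψ₁ ψ₂ ← shape 7 (pair (code φ₁) (code φ₂)) ψ (sym eq) =
  let e₁ , e₂ = pair₂-injective 7 (code φ₁) (code φ₂) (code ψ₁) (code ψ₂) eq
  in cong₂ orF (code-injective φ₁ ψ₁ e₁) (code-injective φ₂ ψ₂ e₂)
code-injective (allF φ) ψ eq with isAll ψ′ ← shape 8 (code φ) ψ (sym eq) =
  cong allF (code-injective φ ψ′ (proj₂ (pair-injective 8 (code φ) 8 (code ψ′) eq)))
code-injective (exF φ) ψ eq with isEx ψ′ ← shape 9 (code φ) ψ (sym eq) =
  cong exF (code-injective φ ψ′ (proj₂ (pair-injective 9 (code φ) 9 (code ψ′) eq)))

neg-involutive : ∀ φ → neg (neg φ) ≡ φ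
neg-involutive (eqF s t)  = refl
neg-involutive (neqF s t) = refl
neg-involutive (Tp t)     = refl
neg-involutive (Tn t)     = refl
neg-involutive (Pp t)     = refl
neg-involutive (Pn t)     = refl
neg-involutive (andF φ ψ) = cong₂ andF (neg-involutive φ) (neg-involutive ψ)
neg-involutive (orF φ ψ)  = cong₂ orF (neg-involutive φ) (neg-involutive ψ)
neg-involutive (allF φ)   = cong allF (neg-involutive φ)
neg-involutive (exF φ)    = cong exF (neg-involutive φ)

ev-num : ∀ ρ n → ev ρ (num n) ≡ n
ev-num ρ zero    = refl
ev-num ρ (suc n) = cong suc (ev-num ρ n)

ev-renTm : ∀ {ρ ρ′ r} t → (∀ i → ρ (r i) ≡ ρ′ i) → ev ρ (renTm r t) ≡ ev ρ′ t
ev-renTm (var i)     h = h i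
ev-renTm zer         h = refl
ev-renTm (suc' t)    h = cong suc (ev-renTm t h)
ev-renTm (plus s t)  h = cong₂ _+_ (ev-renTm s h) (ev-renTm t h)
ev-renTm (times s t) h = cong₂ _*_ (ev-renTm s h) (ev-renTm t h)

ev-subTm : ∀ {ρ ρ′ σ} t → (∀ i → ev ρ (σ i) ≡ ρ′ i) → ev ρ (subTm σ t) ≡ ev ρ′ t
ev-subTm (var i)     h = h i
ev-subTm zer         h = refl
ev-subTm (suc' t)    h = cong suc (ev-subTm t h)
ev-subTm (plus s t)  h = cong₂ _+_ (ev-subTm s h) (ev-subTm t h)
ev-subTm (times s t) h = cong₂ _*_ (ev-subTm s h) (ev-subTm t h)

liftR-agrees : ∀ {ρ ρ′ r} → (∀ i → ρ (r i) ≡ ρ′ i) →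
               ∀ n i → (n ∷ₑ ρ) (liftR r i) ≡ (n ∷ₑ ρ′) i
liftR-agrees h n zero    = refl
liftR-agrees h n (suc i) = h i

liftS-agrees : ∀ {ρ ρ′ σ} → (∀ i → ev ρ (σ i) ≡ ρ′ i) →
               ∀ n i → ev (n ∷ₑ ρ) (liftS σ i) ≡ (n ∷ₑ ρ′) i
liftS-agrees h n zero    = refl
liftS-agrees {σ = σ} h n (suc i) = trans (ev-renTm (σ i) (λ _ → refl)) (h i)

-- Friedman's A-translation, under which every rule of PA[SK] is valid constructively.
module ATranslation (I : Interp) (R : Set) where

  ¬¬ᴿ_ : Set → Set
  ¬¬ᴿ X = (X → R) → R

  pure : ∀ {X} → X → ¬¬ᴿ X
  pure x k = k x

  ¬¬ᴿ-map : ∀ {X Y} → (X → Y) → ¬¬ᴿ X → ¬¬ᴿ Y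
  ¬¬ᴿ-map f h k = h (k ∘ f)

  ¬¬ᴿ-join : ∀ {X} → ¬¬ᴿ (¬¬ᴿ X) → ¬¬ᴿ X
  ¬¬ᴿ-join h k = h (λ h′ → h′ k)

  ¬¬ᴿ-clash : ∀ {X Y} → (X → Y → ⊥) → ¬¬ᴿ X → ¬¬ᴿ Y → R
  ¬¬ᴿ-clash clash hx hy = hx λ x → hy λ y → ⊥-elim (clash x y)

  ¬¬ᴿ-⇔ : ∀ {X Y} → X ⇔ Y → ¬¬ᴿ X ⇔ ¬¬ᴿ Y
  ¬¬ᴿ-⇔ X⇔Y = mk⇔ (¬¬ᴿ-map (to X⇔Y)) (¬¬ᴿ-map (from X⇔Y))

  ¬¬ᴿ-subst : ∀ (P : ℕ → Set) {a b} → a ≡ b → ¬¬ᴿ P a ⇔ ¬¬ᴿ P b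
  ¬¬ᴿ-subst P refl = mk⇔ id id

  ¬¬ᴿ-subst₂ : ∀ (P : ℕ → ℕ → Set) {a b c d} → a ≡ c → b ≡ d → ¬¬ᴿ P a b ⇔ ¬¬ᴿ P c d
  ¬¬ᴿ-subst₂ P refl refl = mk⇔ id id

  ∀-⇔ : ∀ {P Q : ℕ → Set} → (∀ n → P n ⇔ Q n) → (∀ n → P n) ⇔ (∀ n → Q n)
  ∀-⇔ P⇔Q = mk⇔ (λ f n → to (P⇔Q n) (f n)) (λ f n → from (P⇔Q n) (f n))

  ∃-⇔ : ∀ {P Q : ℕ → Set} → (∀ n → P n ⇔ Q n) → ∃ P ⇔ ∃ Q
  ∃-⇔ P⇔Q = mk⇔ (λ (n , p) → n , to (P⇔Q n) p) (λ (n , q) → n , from (P⇔Q n) q)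

  Satᴿ : Env → Fm → Set
  Satᴿ ρ (andF φ ψ) = Satᴿ ρ φ × Satᴿ ρ ψ
  Satᴿ ρ (orF φ ψ)  = ¬¬ᴿ (Satᴿ ρ φ ⊎ Satᴿ ρ ψ)
  Satᴿ ρ (allF φ)   = ∀ n → Satᴿ (n ∷ₑ ρ) φ
  Satᴿ ρ (exF φ)    = ¬¬ᴿ (∃ λ n → Satᴿ (n ∷ₑ ρ) φ)
  Satᴿ ρ φ          = ¬¬ᴿ SatE I ρ φ

  Satᴿ-stable : ∀ {ρ} φ → ¬¬ᴿ Satᴿ ρ φ → Satᴿ ρ φ
  Satᴿ-stable (eqF s t)  = ¬¬ᴿ-join
  Satᴿ-stable (neqF s t) = ¬¬ᴿ-join
  Satᴿ-stable (Tp t)     = ¬¬ᴿ-join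
  Satᴿ-stable (Tn t)     = ¬¬ᴿ-join
  Satᴿ-stable (Pp t)     = ¬¬ᴿ-join
  Satᴿ-stable (Pn t)     = ¬¬ᴿ-join
  Satᴿ-stable (andF φ ψ) h = Satᴿ-stable φ (¬¬ᴿ-map proj₁ h) , Satᴿ-stable ψ (¬¬ᴿ-map proj₂ h)
  Satᴿ-stable (orF φ ψ)  = ¬¬ᴿ-join
  Satᴿ-stable (allF φ) h n = Satᴿ-stable φ (¬¬ᴿ-map (λ f → f n) h)
  Satᴿ-stable (exF φ)    = ¬¬ᴿ-join

  Sat⇒Satᴿ : ∀ {ρ} φ → SatE I ρ φ → Satᴿ ρ φ
  Sat⇒Satᴿ (eqF s t)  = pure
  Sat⇒Satᴿ (neqF s t) = pure
  Sat⇒Satᴿ (Tp t)     = pure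
  Sat⇒Satᴿ (Tn t)     = pure
  Sat⇒Satᴿ (Pp t)     = pure
  Sat⇒Satᴿ (Pn t)     = pure
  Sat⇒Satᴿ (andF φ ψ) (p , q) = Sat⇒Satᴿ φ p , Sat⇒Satᴿ ψ q
  Sat⇒Satᴿ (orF φ ψ)  p = pure (Sum.map (Sat⇒Satᴿ φ) (Sat⇒Satᴿ ψ) p)
  Sat⇒Satᴿ (allF φ) f n = Sat⇒Satᴿ φ (f n)
  Sat⇒Satᴿ (exF φ) (n , p) = pure (n , Sat⇒Satᴿ φ p)

  Satᴿ-neg : Consistent I → ∀ {ρ} φ → Satᴿ ρ φ → Satᴿ ρ (neg φ) → R
  Satᴿ-neg _ (eqF s t)  = ¬¬ᴿ-clash λ eq neq → neq eq
  Satᴿ-neg _ (neqF s t) = ¬¬ᴿ-clash id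
  Satᴿ-neg (T± , _) (Tp t) = ¬¬ᴿ-clash (T± _)
  Satᴿ-neg (T± , _) (Tn t) = flip (¬¬ᴿ-clash (T± _))
  Satᴿ-neg (_ , P±) (Pp t) = ¬¬ᴿ-clash (P± _)
  Satᴿ-neg (_ , P±) (Pn t) = flip (¬¬ᴿ-clash (P± _))
  Satᴿ-neg c (andF φ ψ) (p , q) ¬p∨¬q =
    ¬p∨¬q Sum.[ Satᴿ-neg c φ p , Satᴿ-neg c ψ q ]
  Satᴿ-neg c (orF φ ψ) p∨q (¬p , ¬q) =
    p∨q Sum.[ (λ p → Satᴿ-neg c φ p ¬p) , (λ q → Satᴿ-neg c ψ q ¬q) ]
  Satᴿ-neg c (allF φ) f ∃¬p = ∃¬p λ (n , ¬p) → Satᴿ-neg c φ (f n) ¬p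
  Satᴿ-neg c (exF φ) ∃p f = ∃p λ (n , p) → Satᴿ-neg c φ p (f n)

  Satᴿ-ren : ∀ φ {ρ ρ′ r} → (∀ i → ρ (r i) ≡ ρ′ i) → Satᴿ ρ (renFm r φ) ⇔ Satᴿ ρ′ φ
  Satᴿ-ren (eqF s t)  h = ¬¬ᴿ-subst₂ _≡_ (ev-renTm s h) (ev-renTm t h)
  Satᴿ-ren (neqF s t) h = ¬¬ᴿ-subst₂ (λ a b → ¬ a ≡ b) (ev-renTm s h) (ev-renTm t h)
  Satᴿ-ren (Tp t)     h = ¬¬ᴿ-subst (T⁺ I) (ev-renTm t h)
  Satᴿ-ren (Tn t)     h = ¬¬ᴿ-subst (T⁻ I) (ev-renTm t h)
  Satᴿ-ren (Pp t)     h = ¬¬ᴿ-subst (P⁺ I) (ev-renTm t h)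
  Satᴿ-ren (Pn t)     h = ¬¬ᴿ-subst (P⁻ I) (ev-renTm t h)
  Satᴿ-ren (andF φ ψ) h = Satᴿ-ren φ h ×-⇔ Satᴿ-ren ψ h
  Satᴿ-ren (orF φ ψ)  h = ¬¬ᴿ-⇔ (Satᴿ-ren φ h ⊎-⇔ Satᴿ-ren ψ h)
  Satᴿ-ren (allF φ)   h = ∀-⇔ λ n → Satᴿ-ren φ (liftR-agrees h n)
  Satᴿ-ren (exF φ)    h = ¬¬ᴿ-⇔ (∃-⇔ λ n → Satᴿ-ren φ (liftR-agrees h n))

  Satᴿ-sub : ∀ φ {ρ ρ′ σ} → (∀ i → ev ρ (σ i) ≡ ρ′ i) → Satᴿ ρ (subFm σ φ) ⇔ Satᴿ ρ′ φ
  Satᴿ-sub (eqF s t)  h = ¬¬ᴿ-subst₂ _≡_ (ev-subTm s h) (ev-subTm t h)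
  Satᴿ-sub (neqF s t) h = ¬¬ᴿ-subst₂ (λ a b → ¬ a ≡ b) (ev-subTm s h) (ev-subTm t h)
  Satᴿ-sub (Tp t)     h = ¬¬ᴿ-subst (T⁺ I) (ev-subTm t h)
  Satᴿ-sub (Tn t)     h = ¬¬ᴿ-subst (T⁻ I) (ev-subTm t h)
  Satᴿ-sub (Pp t)     h = ¬¬ᴿ-subst (P⁺ I) (ev-subTm t h)
  Satᴿ-sub (Pn t)     h = ¬¬ᴿ-subst (P⁻ I) (ev-subTm t h)
  Satᴿ-sub (andF φ ψ) h = Satᴿ-sub φ h ×-⇔ Satᴿ-sub ψ h
  Satᴿ-sub (orF φ ψ)  h = ¬¬ᴿ-⇔ (Satᴿ-sub φ h ⊎-⇔ Satᴿ-sub ψ h)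
  Satᴿ-sub (allF φ)   h = ∀-⇔ λ n → Satᴿ-sub φ (liftS-agrees h n)
  Satᴿ-sub (exF φ)    h = ¬¬ᴿ-⇔ (∃-⇔ λ n → Satᴿ-sub φ (liftS-agrees h n))

  Satᴿ-sub0 : ∀ φ t {ρ} → Satᴿ ρ (sub0 t φ) ⇔ Satᴿ (ev ρ t ∷ₑ ρ) φ
  Satᴿ-sub0 φ t = Satᴿ-sub φ λ { zero → refl ; (suc i) → refl }

  Satᴿ-subSuc : ∀ φ m {ρ} → Satᴿ (m ∷ₑ ρ) (subSuc φ) ⇔ Satᴿ (suc m ∷ₑ ρ) φ
  Satᴿ-subSuc φ m = Satᴿ-sub φ λ { zero → refl ; (suc i) → refl }

  All-shift : ∀ {ρ} n {Γ} → All (Satᴿ ρ) Γ → All (Satᴿ (n ∷ₑ ρ)) (map shift Γ)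
  All-shift n = All.map⁺ ∘ All.map (λ {φ} → from (Satᴿ-ren φ λ _ → refl))

  Any-unshift : ∀ {ρ} n {Δ} → Any (Satᴿ (n ∷ₑ ρ)) (map shift Δ) → Any (Satᴿ ρ) Δ
  Any-unshift n = Any.map (λ {φ} → to (Satᴿ-ren φ λ _ → refl)) ∘ Any.map⁻

  sound : Consistent I → ∀ {Γ Δ} → Γ ⊢ Δ → ∀ ρ → All (Satᴿ ρ) Γ → ¬¬ᴿ Any (Satᴿ ρ) Δ
  sound c (ax φ∈Γ φ∈Δ) ρ γ k = k (Any.map (λ { refl → All.lookup γ φ∈Γ }) φ∈Δ)
  sound c (struct d Γ⊆ Δ⊆) ρ γ k = sound c d ρ (All.anti-mono Γ⊆ γ) (k ∘ Any-resp-⊆ Δ⊆)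
  sound c (cut φ d₁ d₂) ρ γ k = sound c d₁ ρ γ λ
    { (here p) → sound c d₂ ρ (p ∷ γ) k
    ; (there δ) → k δ }
  sound c (negL {φ = φ} d) ρ (¬p ∷ γ) k = sound c d ρ γ λ
    { (here p) → Satᴿ-neg c φ p ¬p
    ; (there δ) → k δ }
  sound c (andL d) ρ ((p , q) ∷ γ) k = sound c d ρ (p ∷ q ∷ γ) k
  sound c (andR d₁ d₂) ρ γ k = sound c d₁ ρ γ λ
    { (here p) → sound c d₂ ρ γ λ
      { (here q) → k (here (p , q))
      ; (there δ) → k (there δ) }
    ; (there δ) → k (there δ) }
  sound c (orL d₁ d₂) ρ (p∨q ∷ γ) k = p∨q λ
    { (inj₁ p) → sound c d₁ ρ (p ∷ γ) k
    ; (inj₂ q) → sound c d₂ ρ (q ∷ γ) k }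
  sound c (orR d) ρ γ k = sound c d ρ γ λ
    { (here p) → k (here (pure (inj₁ p)))
    ; (there (here q)) → k (here (pure (inj₂ q)))
    ; (there (there δ)) → k (there δ) }
  sound c (allL {φ = φ} t d) ρ (∀p ∷ γ) k =
    sound c d ρ (from (Satᴿ-sub0 φ t) (∀p (ev ρ t)) ∷ γ) k
  -- ∀ over a disjunction is classical: if the side formulas Δ hold we escape to the
  -- outer continuation, which stability of Satᴿ φ permits.
  sound c (allR {φ = φ} d) ρ γ k = k (here λ n → Satᴿ-stable φ λ k′ →
    sound c d (n ∷ₑ ρ) (All-shift n γ) λ
      { (here p) → k′ p
      ; (there δ) → k (there (Any-unshift n δ)) })
  sound c (exL d) ρ (∃p ∷ γ) k =
    ∃p λ (n , p) → sound c d (n ∷ₑ ρ) (p ∷ All-shift n γ) (k ∘ Any-unshift n)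
  sound c (exR {φ = φ} t d) ρ γ k = sound c d ρ γ λ
    { (here p) → k (here (pure (ev ρ t , to (Satᴿ-sub0 φ t) p)))
    ; (there δ) → k (there δ) }
  sound c (ref t) ρ γ k = k (here (pure refl))
  sound c (repl s t φ) ρ (s≡t ∷ p ∷ γ) k = s≡t λ eq →
    k (here (from (Satᴿ-sub0 φ t) (subst (λ v → Satᴿ (v ∷ₑ ρ) φ) eq (to (Satᴿ-sub0 φ s) p))))
  sound c (eqLEM s t) ρ γ k with ev ρ s ≟ ev ρ t
  ... | yes eq = k (here (pure eq))
  ... | no neq = k (there (here (pure neq)))
  sound c (paS0 s) ρ (S≡0 ∷ γ) k = S≡0 λ ()
  sound c (paSinj s t) ρ (S≡S ∷ γ) k = k (here (¬¬ᴿ-map suc-injective S≡S))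
  sound c (paPlus0 s) ρ γ k = k (here (pure (+-identityʳ (ev ρ s))))
  sound c (paPlusS s t) ρ γ k = k (here (pure (+-suc (ev ρ s) (ev ρ t))))
  sound c (paTimes0 s) ρ γ k = k (here (pure (*-zeroʳ (ev ρ s))))
  sound c (paTimesS s t) ρ γ k =
    k (here (pure (trans (*-suc (ev ρ s) (ev ρ t)) (+-comm (ev ρ s) (ev ρ s * ev ρ t)))))
  sound c (ind φ t d) ρ (p₀ ∷ γ) k = k (here (from (Satᴿ-sub0 φ t) (induction (ev ρ t))))
    where
    induction : ∀ m → Satᴿ (m ∷ₑ ρ) φ
    induction zero    = to (Satᴿ-sub0 φ zer) p₀
    induction (suc m) = Satᴿ-stable φ λ k′ →
      sound c d (m ∷ₑ ρ) (induction m ∷ All-shift m γ) λ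
        { (here p) → k′ (to (Satᴿ-subSuc φ m) p)
        ; (there δ) → k (there (Any-unshift m δ)) }

-- Friedman's trick: with R the atomic conclusion itself, its translation ¬¬ᴿ R collapses to R.
sound-¬T : ∀ {I A t} → Consistent I → [ A ] ⊢ [ Tn t ] → Sat I A → Sat I (Tn t)
sound-¬T {I} {A} {t} c d a =
  sound c d _ (Sat⇒Satᴿ A a ∷ []) λ ¬¬t → Any.singleton⁻ ¬¬t id
  where open ATranslation I (Sat I (Tn t))

sound-T : ∀ {I A t} → Consistent I → [ A ] ⊢ [ Tp t ] → Sat I A → Sat I (Tp t)
sound-T {I} {A} {t} c d a =
  sound c d _ (Sat⇒Satᴿ A a ∷ []) λ ¬¬t → Any.singleton⁻ ¬¬t id
  where open ATranslation I (Sat I (Tp t))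

record _⊑_ (I J : Interp) : Set where
  field
    T⁺-⊑ : ∀ {n} → T⁺ I n → T⁺ J n
    T⁻-⊑ : ∀ {n} → T⁻ I n → T⁻ J n
    P⁺-⊑ : ∀ {n} → P⁺ I n → P⁺ J n
    P⁻-⊑ : ∀ {n} → P⁻ I n → P⁻ J n
open _⊑_

⊑-trans : ∀ {I J K} → I ⊑ J → J ⊑ K → I ⊑ K
⊑-trans I⊑J J⊑K = record
  { T⁺-⊑ = T⁺-⊑ J⊑K ∘ T⁺-⊑ I⊑J
  ; T⁻-⊑ = T⁻-⊑ J⊑K ∘ T⁻-⊑ I⊑J
  ; P⁺-⊑ = P⁺-⊑ J⊑K ∘ P⁺-⊑ I⊑J
  ; P⁻-⊑ = P⁻-⊑ J⊑K ∘ P⁻-⊑ I⊑J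
  }

⊑-consistent : ∀ {I J} → I ⊑ J → Consistent J → Consistent I
⊑-consistent I⊑J (T± , P±) = (λ n t⁺ t⁻ → T± n (T⁺-⊑ I⊑J t⁺) (T⁻-⊑ I⊑J t⁻))
                           , (λ n p⁺ p⁻ → P± n (P⁺-⊑ I⊑J p⁺) (P⁻-⊑ I⊑J p⁻))

SatE-mono : ∀ {I J} → I ⊑ J → ∀ {ρ} φ → SatE I ρ φ → SatE J ρ φ
SatE-mono I⊑J (eqF s t)  = id
SatE-mono I⊑J (neqF s t) = id
SatE-mono I⊑J (Tp t)     = T⁺-⊑ I⊑J
SatE-mono I⊑J (Tn t)     = T⁻-⊑ I⊑J
SatE-mono I⊑J (Pp t)     = P⁺-⊑ I⊑J
SatE-mono I⊑J (Pn t)     = P⁻-⊑ I⊑J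
SatE-mono I⊑J (andF φ ψ) = Product.map (SatE-mono I⊑J φ) (SatE-mono I⊑J ψ)
SatE-mono I⊑J (orF φ ψ)  = Sum.map (SatE-mono I⊑J φ) (SatE-mono I⊑J ψ)
SatE-mono I⊑J (allF φ) f n = SatE-mono I⊑J φ (f n)
SatE-mono I⊑J (exF φ)    = Product.map₂ (SatE-mono I⊑J φ)

Pclause-mono : ∀ {I J} → I ⊑ J → ∀ φ → Pclause I φ → Pclause J φ
Pclause-mono I⊑J (Tp t) = P⁺-⊑ I⊑J
Pclause-mono I⊑J (Tn t) = P⁺-⊑ I⊑J
Pclause-mono I⊑J (andF φ ψ) =
  Sum.map (Product.map (P⁺-⊑ I⊑J) (P⁺-⊑ I⊑J))
    (Sum.map (Product.map (T⁺-⊑ I⊑J) (P⁺-⊑ I⊑J)) (Product.map (T⁺-⊑ I⊑J) (P⁺-⊑ I⊑J)))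
Pclause-mono I⊑J (orF φ ψ) =
  Sum.map (Product.map (P⁺-⊑ I⊑J) (P⁺-⊑ I⊑J))
    (Sum.map (Product.map (T⁻-⊑ I⊑J) (P⁺-⊑ I⊑J)) (Product.map (T⁻-⊑ I⊑J) (P⁺-⊑ I⊑J)))
Pclause-mono I⊑J (allF φ) =
  Product.map (Product.map₂ (P⁺-⊑ I⊑J)) (Sum.map (P⁺-⊑ I⊑J) (T⁺-⊑ I⊑J) ∘_)
Pclause-mono I⊑J (exF φ) =
  Product.map (Product.map₂ (P⁺-⊑ I⊑J)) (Sum.map (P⁺-⊑ I⊑J) (T⁻-⊑ I⊑J) ∘_)

CodesOf-mono : ∀ {Q Q′ : Fm → Set} → (∀ {φ} → Q φ → Q′ φ) → ∀ {n} → CodesOf Q n → CodesOf Q′ n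
CodesOf-mono f (φ , φ-sentence , code≡n , q) = φ , φ-sentence , code≡n , f q

Jump-mono : ∀ {I J} → I ⊑ J → Jump I ⊑ Jump J
Jump-mono I⊑J = record
  { T⁺-⊑ = CodesOf-mono λ {φ} → SatE-mono I⊑J φ
  ; T⁻-⊑ = CodesOf-mono λ {φ} → SatE-mono I⊑J (neg φ)
  ; P⁺-⊑ = CodesOf-mono λ {φ} → Product.map₂ (Sum.map₂ (Pclause-mono I⊑J φ))
  ; P⁻-⊑ = CodesOf-mono λ {φ} → SatE-mono I⊑J (orF φ (neg φ))
  }

emptyI-⊑ : ∀ {J} → emptyI ⊑ J
emptyI-⊑ = record { T⁺-⊑ = λ () ; T⁻-⊑ = λ () ; P⁺-⊑ = λ () ; P⁻-⊑ = λ () }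

stage-limit-upper : ∀ f k → stage (f k) ⊑ stage (limO f)
stage-limit-upper f k = record
  { T⁺-⊑ = k ,_ ; T⁻-⊑ = k ,_ ; P⁺-⊑ = k ,_ ; P⁻-⊑ = k ,_ }

stage-limit-least : ∀ f {J} → (∀ k → stage (f k) ⊑ J) → stage (limO f) ⊑ J
stage-limit-least f ub = record
  { T⁺-⊑ = λ (k , x) → T⁺-⊑ (ub k) x
  ; T⁻-⊑ = λ (k , x) → T⁻-⊑ (ub k) x
  ; P⁺-⊑ = λ (k , x) → P⁺-⊑ (ub k) x
  ; P⁻-⊑ = λ (k , x) → P⁻-⊑ (ub k) x
  }

stage-⊑-suc : ∀ α → stage α ⊑ stage (sucO α)
stage-⊑-suc zeroO    = emptyI-⊑
stage-⊑-suc (sucO α) = Jump-mono (stage-⊑-suc α)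
stage-⊑-suc (limO f) = stage-limit-least f λ k →
  ⊑-trans (stage-⊑-suc (f k)) (Jump-mono (stage-limit-upper f k))

CodesOf-quote : ∀ {Q : Fm → Set} {ρ} φ → CodesOf Q (ev ρ ⌜ φ ⌝) → Q φ
CodesOf-quote {Q} {ρ} φ (ψ , _ , code≡ , q) =
  subst Q (code-injective ψ φ (trans code≡ (ev-num ρ (code φ)))) q

B-unsatisfied : ∀ {I φ} → InB φ → Consistent I →
                ¬ Sat I (Tp ⌜ φ ⌝) × ¬ Sat I (Tn ⌜ φ ⌝) → ¬ Sat I φ × ¬ Sat I (neg φ)
B-unsatisfied (_ , φ⇒¬T , _ , ¬φ⇒T , _) c (¬T , ¬F) =
  ¬F ∘ sound-¬T c φ⇒¬T , ¬T ∘ sound-T c ¬φ⇒T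

B-undetermined : ∀ {φ} → InB φ → ∀ α → Consistent (stage α) →
                 ¬ Sat (stage α) (Tp ⌜ φ ⌝) × ¬ Sat (stage α) (Tn ⌜ φ ⌝)
B-undetermined φ∈B zeroO c = (λ ()) , (λ ())
B-undetermined {φ} φ∈B (sucO α) c =
  let cα = ⊑-consistent (stage-⊑-suc α) c
      ¬φ , ¬¬φ = B-unsatisfied φ∈B cα (B-undetermined φ∈B α cα)
  in ¬φ ∘ CodesOf-quote φ , ¬¬φ ∘ CodesOf-quote φ
B-undetermined φ∈B (limO f) c =
  (λ (k , t) → proj₁ (ih k) t) , (λ (k , t) → proj₂ (ih k) t)
  where
  ih = λ k → B-undetermined φ∈B (f k) (⊑-consistent (stage-limit-upper f k) c)

B-neg-not-false : ∀ {φ} → InB φ → ∀ α → Consistent (stage α) → ¬ Sat (stage α) (Tn ⌜ neg φ ⌝)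
B-neg-not-false φ∈B zeroO c ()
B-neg-not-false {φ} φ∈B (sucO α) c t⁻ =
  let cα = ⊑-consistent (stage-⊑-suc α) c
      ¬φ , _ = B-unsatisfied φ∈B cα (B-undetermined φ∈B α cα)
  in ¬φ (subst (Sat (stage α)) (neg-involutive φ) (CodesOf-quote (neg φ) t⁻))
B-neg-not-false φ∈B (limO f) c (k , t⁻) =
  B-neg-not-false φ∈B (f k) (⊑-consistent (stage-limit-upper f k) c) t⁻

Π-unsatisfied : ∀ {φ} → InΠ φ → ∀ α → Consistent (stage α) →
                ¬ Sat (stage α) φ × ¬ Sat (stage α) (Tn ⌜ φ ⌝)
Π-unsatisfied (inj₁ φ∈B) α c =
  let ¬T , ¬F = B-undetermined φ∈B α c
  in proj₁ (B-unsatisfied φ∈B c (¬T , ¬F)) , ¬F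
Π-unsatisfied {φ} (inj₂ ¬φ∈B) α c =
  subst (λ χ → ¬ Sat (stage α) χ × ¬ Sat (stage α) (Tn ⌜ χ ⌝)) (neg-involutive φ)
    (proj₂ (B-unsatisfied ¬φ∈B c (B-undetermined ¬φ∈B α c)) , B-neg-not-false ¬φ∈B α c)

mainTheorem6 : (α : Ord) (φ : Fm) → Consistent (stage α) → InΠ φ →
    SatSeq (stage α) [ φ ] [ Tn ⌜ φ ⌝ ] × SatSeq (stage α) [ Tn ⌜ φ ⌝ ] [ φ ]
mainTheorem6 α φ c φ∈Π =
  let ¬φ , ¬F = Π-unsatisfied φ∈Π α c
  in ⊥-elim ∘ ¬φ ∘ All.singleton⁻ , ⊥-elim ∘ ¬F ∘ All.singleton⁻
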